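{- Let $L$ be a complete lattice. (1) A complementary choice function $f$ on $L$ is uniquely determined by its set of fixed elements $Fix(f)=\{x\in L: f(x)=x\}$. (2) If $F\subseteq L$ is a complete join-subsemilattice of $L$ (i.e. $\bigvee_{i\in I}x_i\in F$ for every family $(x_i)_{i\in I}$ of elements of $F$), then there exists a unique complementary choice function $f$ on $L$ with $Fix(f)=F$.
   Context: A choice function (CF) on a lattice $L$ is a map $f:L\to L$ with $f(x)\le x$ for all $x\in L$. It is monotonic if $x\le y$ implies $f(x)\le f(y)$; consistent if $f(x)\le y\le x$ implies $f(y)=f(x)$; complementary if monotonic and consistent. -}

module Defs where

open import Level using (Level; suc)
open import Relation.Binary.PropositionalEquality using (_≡_)
open import Relation.Binary.Structures using (IsPartialOrder)
open import Data.Product using (_×_)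
open import Function.Bundles using (_⇔_)

record CompleteLattice (c : Level) : Set (suc c) where
  field
    Carrier        : Set c
    _≤_            : Carrier → Carrier → Set c
    isPartialOrder : IsPartialOrder _≡_ _≤_
    ⋁              : (I : Set c) → (I → Carrier) → Carrier
    ⋁-upper        : (I : Set c) (x : I → Carrier) (i : I) → x i ≤ ⋁ I x
    ⋁-least        : (I : Set c) (x : I → Carrier) (z : Carrier) →
                     ((i : I) → x i ≤ z) → ⋁ I x ≤ z

module _ {c : Level} (L : CompleteLattice c) where
  open CompleteLattice L

  IsChoiceFunction : (Carrier → Carrier) → Set c
  IsChoiceFunction f = ∀ x → f x ≤ x

  IsMonotonic : (Carrier → Carrier) → Set c
  IsMonotonic f = ∀ x y → x ≤ y → f x ≤ f y

  IsConsistent : (Carrier → Carrier) → Set c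
  IsConsistent f = ∀ x y → f x ≤ y → y ≤ x → f y ≡ f x

  IsComplementaryCF : (Carrier → Carrier) → Set c
  IsComplementaryCF f = IsChoiceFunction f × IsMonotonic f × IsConsistent f

  FixEq : (Carrier → Carrier) → (Carrier → Set c) → Set c
  FixEq f F = ∀ x → (f x ≡ x) ⇔ F x

  IsCompleteJoinSubsemilattice : (Carrier → Set c) → Set (suc c)
  IsCompleteJoinSubsemilattice F =
    (I : Set c) (x : I → Carrier) → (∀ i → F (x i)) → F (⋁ I x)

-- A complementary choice function f sends x to the greatest fixed element
-- below x: f x is fixed (consistency with y = f x), and every fixed y ≤ x
-- satisfies y = f y ≤ f x (monotonicity).  So f is determined by Fix(f).
-- Conversely, for a complete join-subsemilattice F the map
-- x ↦ ⋁ {y ∈ F | y ≤ x} lies in F, and it is a complementary choice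
-- function whose fixed elements are exactly F.
module Submission where

open import Defs
open import Level using (Level)
open import Relation.Binary.PropositionalEquality using (_≡_; subst)
open import Relation.Binary.Structures using (IsPartialOrder)
open import Data.Product using (_×_; Σ; _,_; proj₁; proj₂)
open import Function.Bundles using (_⇔_; mk⇔; Equivalence)
open import Function.Properties.Equivalence using () renaming (sym to ⇔-sym; trans to ⇔-trans)

module _ {c : Level} (L : CompleteLattice c) where
  open CompleteLattice L
  open IsPartialOrder isPartialOrder using (antisym) renaming (refl to ≤-refl; trans to ≤-trans)

  choice∧consistent⇒idempotent : (f : Carrier → Carrier) →
    IsChoiceFunction L f → IsConsistent L f → ∀ x → f (f x) ≡ f x
  choice∧consistent⇒idempotent f choice consistent x = consistent x (f x) ≤-refl (choice x)

  fix-⊆⇒≤ : (f g : Carrier → Carrier) → IsComplementaryCF L f → IsMonotonic L g →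
    (∀ x → f x ≡ x → g x ≡ x) → ∀ x → f x ≤ g x
  fix-⊆⇒≤ f g (choice , _ , consistent) g-mono fix⊆ x =
    subst (_≤ g x) (fix⊆ (f x) (choice∧consistent⇒idempotent f choice consistent x))
      (g-mono (f x) x (choice x))

  complementaryCF-unique : (f g : Carrier → Carrier) →
    IsComplementaryCF L f → IsComplementaryCF L g →
    (∀ x → (f x ≡ x) ⇔ (g x ≡ x)) → ∀ x → f x ≡ g x
  complementaryCF-unique f g f-cf g-cf fix⇔ x = antisym
    (fix-⊆⇒≤ f g f-cf (proj₁ (proj₂ g-cf)) (λ y → Equivalence.to (fix⇔ y)) x)
    (fix-⊆⇒≤ g f g-cf (proj₁ (proj₂ f-cf)) (λ y → Equivalence.from (fix⇔ y)) x)

  module Interior (F : Carrier → Set c) where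

    Below : Carrier → Set c
    Below x = Σ Carrier λ y → F y × y ≤ x

    interior : Carrier → Carrier
    interior x = ⋁ (Below x) proj₁

    interior-greatest : ∀ {x y} → F y → y ≤ x → y ≤ interior x
    interior-greatest {x} {y} Fy y≤x = ⋁-upper (Below x) proj₁ (y , Fy , y≤x)

    interior-choice : IsChoiceFunction L interior
    interior-choice x = ⋁-least (Below x) proj₁ x (λ (_ , _ , y≤x) → y≤x)

    interior-mono : IsMonotonic L interior
    interior-mono x z x≤z = ⋁-least (Below x) proj₁ (interior z)
      (λ (_ , Fy , y≤x) → interior-greatest Fy (≤-trans y≤x x≤z))

    module _ (closed : IsCompleteJoinSubsemilattice L F) where

      interior-∈ : ∀ x → F (interior x)
      interior-∈ x = closed (Below x) proj₁ (λ (_ , Fy , _) → Fy)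

      interior-consistent : IsConsistent L interior
      interior-consistent x y ix≤y y≤x =
        antisym (interior-mono y x y≤x) (interior-greatest (interior-∈ x) ix≤y)

      interior-complementary : IsComplementaryCF L interior
      interior-complementary = interior-choice , interior-mono , interior-consistent

      fix-interior : FixEq L interior F
      fix-interior x = mk⇔
        (λ ix≡x → subst F ix≡x (interior-∈ x))
        (λ Fx → antisym (interior-choice x) (interior-greatest Fx ≤-refl))

  complementaryCF-exists-unique : (F : Carrier → Set c) → IsCompleteJoinSubsemilattice L F →
    Σ (Carrier → Carrier) λ f →
      (IsComplementaryCF L f × FixEq L f F) ×
      ((g : Carrier → Carrier) → IsComplementaryCF L g → FixEq L g F → ∀ x → g x ≡ f x)
  complementaryCF-exists-unique F closed =
    interior , (interior-complementary closed , fix-interior closed) ,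
    λ g g-cf fix-g → complementaryCF-unique g interior g-cf (interior-complementary closed)
      (λ x → ⇔-trans (fix-g x) (⇔-sym (fix-interior closed x)))
    where open Interior F

proposition7 : {c : Level} (L : CompleteLattice c) →
    let open CompleteLattice L in
    ((f g : Carrier → Carrier) →
    IsComplementaryCF L f → IsComplementaryCF L g →
    (∀ x → (f x ≡ x) ⇔ (g x ≡ x)) →
    ∀ x → f x ≡ g x)
    ×
    ((F : Carrier → Set c) → IsCompleteJoinSubsemilattice L F →
    Σ (Carrier → Carrier) λ f →
    (IsComplementaryCF L f × FixEq L f F) ×
    ((g : Carrier → Carrier) → IsComplementaryCF L g → FixEq L g F →
    ∀ x → g x ≡ f x))
proposition7 L = complementaryCF-unique L , complementaryCF-exists-unique L
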